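{- Let $(A,\le,0,1)$ be a bounded poset satisfying both the Ascending Chain Condition and the Descending Chain Condition, let $(T,R)$ be a time frame with $R$ serial, and let $P,F,H,G$ be the tense operators induced by $(T,R)$. Then for all $B,C\in\mathcal P_+(A^T)$: (1) $P(B\odot B)=P(B)$ and $F(B\odot B)=F(B)$; (2) $\operatorname{Max}L(P(B\odot C))\le_1\operatorname{Max}L(P(B))\odot\operatorname{Max}L(P(C))$; (3) $\operatorname{Max}L(F(B\odot C))\le_1\operatorname{Max}L(F(B))\odot\operatorname{Max}L(F(C))$.
   Context: ACC: no infinite strictly ascending chains; DCC: no infinite strictly descending chains. For $X\subseteq A$: $L(X)$, $U(X)$ the sets of lower/upper bounds, $\operatorname{Max}X,\operatorname{Min}X$ the maximal/minimal elements. $\mathcal P_+(X)$ = nonempty subsets. For subsets $X,Y$: $X\le Y$ iff $x\le y$ for all $x\in X,y\in Y$; $X\le_1Y$ iff every $x\in X$ lies below some $y\in Y$; $X\le_2Y$ iff every $y\in Y$ lies above some $x\in X$. Connectives: for $x,y\in A$, $x\odot y=\operatorname{Max}L(\{x,y\})$; for nonempty $B,C\subseteq A$, $B\odot C=\operatorname{Max}\{a\in A\mid a\le U(\bigcup\{b\odot c\mid b\in B,c\in C\})\}$. For $B,C\in(\mathcal P_+A)^T$, $(B\odot C)(t)=B(t)\odot C(t)$; for $B\subseteq A^T$, $B(t)=\{q(t)\mid q\in B\}$, so $B\odot C$ is defined for $B,C\in\mathcal P_+(A^T)$ as the function $t\mapsto B(t)\odot C(t)$. For a function $Z$ from $T$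 to subsets of $A$, $L(Z)$ and $\operatorname{Max}L(Z)$ are taken pointwise, and $\le_1$ between such functions is pointwise in $t$. A time frame is $(T,R)$, $T\ne\emptyset$, $R\subseteq T^2$; serial: each $s$ has $r,t$ with $rRs$, $sRt$. The induced tense operators $P,F,H,G:\mathcal P_+(A^T)\to(\mathcal P_+A)^T$ are $P(B)(s)=\operatorname{Min}U(\{q(t)\mid q\in B, tRs\})$, $F(B)(s)=\operatorname{Min}U(\{q(t)\mid q\in B, sRt\})$, $H(B)(s)=\operatorname{Max}L(\{q(t)\mid q\in B,tRs\})$, $G(B)(s)=\operatorname{Max}L(\{q(t)\mid q\in B,sRt\})$. An element $Z\in(\mathcal P_+A)^T$ is fed to these operators as the subset $\{q\in A^T\mid q(t)\in Z(t)\ \forall t\}$ of $A^T$. -}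

module Defs where

open import Data.Nat using (ℕ; suc)
open import Data.Product using (Σ; Σ-syntax; _×_; _,_)
open import Data.Sum using (_⊎_)
open import Relation.Binary.PropositionalEquality using (_≡_; _≢_)
open import Relation.Binary.Structures using (IsPartialOrder)
open import Relation.Nullary using (¬_)

Subset : Set → Set₁
Subset X = X → Set

Nonempty : {X : Set} → Subset X → Set
Nonempty {X} S = Σ X S

module Order {A : Set} (_≤_ : A → A → Set) where

  _<_ : A → A → Set
  x < y = (x ≤ y) × (x ≢ y)

  record IsBoundedPoset (𝟘 𝟙 : A) : Set where
    field
      isPartialOrder : IsPartialOrder _≡_ _≤_
      bot : ∀ x → 𝟘 ≤ x
      top : ∀ x → x ≤ 𝟙

  ACC : Set
  ACC = ¬ (Σ[ f ∈ (ℕ → A) ] (∀ n → f n < f (suc n)))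

  DCC : Set
  DCC = ¬ (Σ[ f ∈ (ℕ → A) ] (∀ n → f (suc n) < f n))

  L : Subset A → Subset A
  L X a = ∀ x → X x → a ≤ x

  U : Subset A → Subset A
  U X a = ∀ x → X x → x ≤ a

  Max : Subset A → Subset A
  Max X a = X a × (∀ y → X y → a ≤ y → y ≡ a)

  Min : Subset A → Subset A
  Min X a = X a × (∀ y → X y → y ≤ a → y ≡ a)

  pair : A → A → Subset A
  pair x y z = (z ≡ x) ⊎ (z ≡ y)

  _≤₁_ : Subset A → Subset A → Set
  X ≤₁ Y = ∀ x → X x → Σ[ y ∈ A ] (Y y × x ≤ y)

  _⊙_ : A → A → Subset A
  x ⊙ y = Max (L (pair x y))

  ⋃⊙ : Subset A → Subset A → Subset A
  ⋃⊙ B C z = Σ[ b ∈ A ] Σ[ c ∈ A ] (B b × C c × (b ⊙ c) z)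

  _⊙ˢ_ : Subset A → Subset A → Subset A
  B ⊙ˢ C = Max (λ a → ∀ u → U (⋃⊙ B C) u → a ≤ u)

  module Time (T : Set) where

    TSub : Set₁
    TSub = T → Subset A

    _⊙ᵀ_ : TSub → TSub → TSub
    (B ⊙ᵀ C) t = B t ⊙ˢ C t

    MaxLᵀ : TSub → TSub
    MaxLᵀ Z t = Max (L (Z t))

    _≤₁ᵀ_ : TSub → TSub → Set
    Z ≤₁ᵀ W = ∀ t → Z t ≤₁ W t

    _≐ᵀ_ : TSub → TSub → Set
    Z ≐ᵀ W = ∀ t a → (Z t a → W t a) × (W t a → Z t a)

    FSub : Set₁
    FSub = (T → A) → Set

    eval : FSub → TSub
    eval B t a = Σ[ q ∈ (T → A) ] (B q × q t ≡ a)

    _⊙ᶠ_ : FSub → FSub → TSub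
    B ⊙ᶠ C = eval B ⊙ᵀ eval C

    -- Z ∈ (P A)^T fed to operators as { q | ∀ t, q(t) ∈ Z(t) }
    feed : TSub → FSub
    feed Z q = ∀ t → Z t (q t)

    Serial : (T → T → Set) → Set
    Serial R = ∀ s → (Σ[ r ∈ T ] R r s) × (Σ[ t ∈ T ] R s t)

    module Tense (R : T → T → Set) where

      past : FSub → T → Subset A
      past B s a = Σ[ q ∈ (T → A) ] Σ[ t ∈ T ] (B q × R t s × q t ≡ a)

      future : FSub → T → Subset A
      future B s a = Σ[ q ∈ (T → A) ] Σ[ t ∈ T ] (B q × R s t × q t ≡ a)

      P F H G : FSub → TSub
      P B s = Min (U (past B s))
      F B s = Min (U (future B s))
      H B s = Max (L (past B s))
      G B s = Max (L (future B s))

{-# OPTIONS --safe #-}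
module Submission where

-- Upper bounds do not see the connective.  An element of X ⊙ Y lies below every upper
-- bound of X and of Y, and every x ∈ X lies below a maximal element of L(U(X ⊙ X)) by ACC,
-- which (choosing classically at the other instants) is the value of a member of
-- feed (B ⊙ᶠ B); so B ⊙ B and B have the same upper bounds at each instant, giving (1).
-- For (2) and (3): every upper bound of B or of C bounds B ⊙ C and by DCC lies above a
-- minimal one, so a lower bound of the least upper bounds of B ⊙ C is one of those of B
-- and of C, and ACC enlarges it into Max L(F B) ⊙ Max L(F C).

open import Defs
open import Axiom.ExcludedMiddle using (ExcludedMiddle)
open import Level using (0ℓ)
open import Data.Nat using (ℕ; zero; suc)
open import Data.Product using (Σ-syntax; _×_; _,_; proj₁; proj₂)
open import Data.Sum using (inj₁; inj₂)
open import Data.Empty using (⊥-elim)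
open import Function using (flip)
open import Relation.Nullary using (¬_; yes; no)
open import Relation.Binary.PropositionalEquality using (_≡_; refl; sym)
open import Relation.Binary.Structures using (IsPartialOrder)

module ChainCondition (em : ExcludedMiddle 0ℓ) {A : Set} (_⊑_ : A → A → Set)
  (⊑-refl : ∀ {x} → x ⊑ x) (⊑-trans : ∀ {x y z} → x ⊑ y → y ⊑ z → x ⊑ z) where
  open Order _⊑_ using (_<_; ACC; Max)

  non-maximal⇒greater : (S : Subset A) → ∀ {b} → S b → ¬ Max S b → Σ[ y ∈ A ] S y × b < y
  non-maximal⇒greater S {b} Sb ¬max with em {Σ[ y ∈ A ] S y × b < y}
  ... | yes greater = greater
  ... | no ¬greater = ⊥-elim (¬max (Sb , maximal))
    where
    maximal : ∀ y → S y → b ⊑ y → y ≡ b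
    maximal y Sy b⊑y with em {y ≡ b}
    ... | yes y≡b = y≡b
    ... | no y≢b = ⊥-elim (¬greater (y , Sy , b⊑y , λ b≡y → y≢b (sym b≡y)))

  ACC⇒maximal-above : ACC → (S : Subset A) → ∀ {a} → S a → Σ[ m ∈ A ] Max S m × a ⊑ m
  ACC⇒maximal-above acc S {a} Sa with em {Σ[ m ∈ A ] Max S m × a ⊑ m}
  ... | yes found = found
  ... | no none = ⊥-elim (acc ((λ n → proj₁ (chain n)) , λ n → proj₂ (greater (chain n))))
    where
    Above : Set
    Above = Σ[ b ∈ A ] S b × a ⊑ b

    greater : (b : Above) → Σ[ c ∈ Above ] proj₁ b < proj₁ c
    greater (b , Sb , a⊑b) with non-maximal⇒greater S Sb (λ max → none (b , max , a⊑b))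
    ... | c , Sc , b<c = (c , Sc , ⊑-trans a⊑b (proj₁ b<c)) , b<c

    chain : ℕ → Above
    chain zero    = a , Sa , ⊑-refl
    chain (suc n) = proj₁ (greater (chain n))

module Connective (em : ExcludedMiddle 0ℓ) {A : Set} {_≤_ : A → A → Set}
  (isPartialOrder : IsPartialOrder _≡_ _≤_) where
  open Order _≤_
  open IsPartialOrder isPartialOrder using (antisym) renaming (refl to ≤-refl; trans to ≤-trans)

  ACC⇒maximal-above : ACC → (S : Subset A) → ∀ {a} → S a → Σ[ m ∈ A ] Max S m × a ≤ m
  ACC⇒maximal-above = ChainCondition.ACC⇒maximal-above em _≤_ ≤-refl ≤-trans

  DCC⇒minimal-below : DCC → (S : Subset A) → ∀ {a} → S a → Σ[ m ∈ A ] Min S m × m ≤ a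
  DCC⇒minimal-below dcc = ChainCondition.ACC⇒maximal-above em (flip _≤_) ≤-refl (flip ≤-trans)
    λ (f , descending) → dcc (f , λ n → proj₁ (descending n) , λ e → proj₂ (descending n) (sym e))

  ⊙-lowerˡ : ∀ {b c z} → (b ⊙ c) z → z ≤ b
  ⊙-lowerˡ (z≤bc , _) = z≤bc _ (inj₁ refl)

  ⊙-lowerʳ : ∀ {b c z} → (b ⊙ c) z → z ≤ c
  ⊙-lowerʳ (z≤bc , _) = z≤bc _ (inj₂ refl)

  ⊙-idem : ∀ x → (x ⊙ x) x
  ⊙-idem x = x≤xx , λ y y≤xx x≤y → antisym (y≤xx x (inj₁ refl)) x≤y
    where
    x≤xx : L (pair x x) x
    x≤xx _ (inj₁ refl) = ≤-refl
    x≤xx _ (inj₂ refl) = ≤-refl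

  U⇒U-⋃⊙ˡ : ∀ {X Y u} → U X u → U (⋃⊙ X Y) u
  U⇒U-⋃⊙ˡ u≥X z (b , c , Xb , Yc , z∈bc) = ≤-trans (⊙-lowerˡ z∈bc) (u≥X b Xb)

  U⇒U-⋃⊙ʳ : ∀ {X Y u} → U Y u → U (⋃⊙ X Y) u
  U⇒U-⋃⊙ʳ u≥Y z (b , c , Xb , Yc , z∈bc) = ≤-trans (⊙-lowerʳ z∈bc) (u≥Y c Yc)

  U-⋃⊙-diag⇒U : ∀ {X u} → U (⋃⊙ X X) u → U X u
  U-⋃⊙-diag⇒U u≥XX x Xx = u≥XX x (x , x , Xx , Xx , ⊙-idem x)

  ⊙ˢ-below-Uˡ : ∀ {X Y a u} → (X ⊙ˢ Y) a → U X u → a ≤ u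
  ⊙ˢ-below-Uˡ (a≤U , _) u≥X = a≤U _ (U⇒U-⋃⊙ˡ u≥X)

  ⊙ˢ-below-Uʳ : ∀ {X Y a u} → (X ⊙ˢ Y) a → U Y u → a ≤ u
  ⊙ˢ-below-Uʳ (a≤U , _) u≥Y = a≤U _ (U⇒U-⋃⊙ʳ u≥Y)

  ⊙ˢ-diag-above : ACC → ∀ {X a} → X a → Σ[ m ∈ A ] (X ⊙ˢ X) m × a ≤ m
  ⊙ˢ-diag-above acc Xa =
    ACC⇒maximal-above acc _ λ u u≥XX → U-⋃⊙-diag⇒U u≥XX _ Xa

  ⊙ˢ-nonempty : ACC → ∀ {𝟘} → (∀ x → 𝟘 ≤ x) → ∀ X Y → Σ[ m ∈ A ] (X ⊙ˢ Y) m
  ⊙ˢ-nonempty acc {𝟘} 𝟘≤ X Y =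
    let (m , m∈XY , _) = ACC⇒maximal-above acc _ {𝟘} λ u _ → 𝟘≤ u in m , m∈XY

  ⊙-above : ACC → ∀ {b c x} → x ≤ b → x ≤ c → Σ[ z ∈ A ] (b ⊙ c) z × x ≤ z
  ⊙-above acc {b} {c} {x} x≤b x≤c = ACC⇒maximal-above acc _ x≤bc
    where
    x≤bc : L (pair b c) x
    x≤bc _ (inj₁ refl) = x≤b
    x≤bc _ (inj₂ refl) = x≤c

  common-lower-bound⇒below-⊙ˢ : ACC → ∀ {Y Z x} → L Y x → L Z x →
    Σ[ y ∈ A ] (Max (L Y) ⊙ˢ Max (L Z)) y × x ≤ y
  common-lower-bound⇒below-⊙ˢ acc x≤Y x≤Z =
    let (b , b∈ , x≤b) = ACC⇒maximal-above acc _ x≤Y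
        (c , c∈ , x≤c) = ACC⇒maximal-above acc _ x≤Z
        (z , z∈bc , x≤z) = ⊙-above acc x≤b x≤c
    in ACC⇒maximal-above acc _ λ u u≥⋃ → ≤-trans x≤z (u≥⋃ z (b , c , b∈ , c∈ , z∈bc))

  Min-U-cong : ∀ {X Y} → (∀ u → U X u → U Y u) → (∀ u → U Y u → U X u) →
    ∀ {a} → Min (U X) a → Min (U Y) a
  Min-U-cong UX⊆UY UY⊆UX (a≥X , minimal) = UX⊆UY _ a≥X , λ y y≥Y y≤a → minimal y (UY⊆UX y y≥Y) y≤a

  L-Min-U-antitone : DCC → ∀ {Y W} → (∀ u → U Y u → U W u) →
    ∀ {x} → L (Min (U W)) x → L (Min (U Y)) x
  L-Min-U-antitone dcc UY⊆UW x≤minW p (p≥Y , _) =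
    let (m , m∈minW , m≤p) = DCC⇒minimal-below dcc (U _) (UY⊆UW p p≥Y)
    in ≤-trans (x≤minW m m∈minW) m≤p

module FutureOperator (em : ExcludedMiddle 0ℓ) {A : Set} {_≤_ : A → A → Set}
  (isPartialOrder : IsPartialOrder _≡_ _≤_) (T : Set) (R : T → T → Set) where
  open Order _≤_
  open Time T
  open Tense R
  open Connective em isPartialOrder
  open IsPartialOrder isPartialOrder using () renaming (trans to ≤-trans)

  feed-through : ∀ {Z : TSub} → (∀ t → Σ[ a ∈ A ] Z t a) →
    ∀ {t z} → Z t z → Σ[ q ∈ (T → A) ] feed Z q × q t ≡ z
  feed-through {Z} inhabited {t} {z} z∈Zt = q , q∈Z , q-at-t
    where
    q : T → A
    q t' with em {t ≡ t'}
    ... | yes _ = z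
    ... | no _  = proj₁ (inhabited t')

    q∈Z : feed Z q
    q∈Z t' with em {t ≡ t'}
    ... | yes refl = z∈Zt
    ... | no _     = proj₂ (inhabited t')

    q-at-t : q t ≡ z
    q-at-t with em {t ≡ t}
    ... | yes _  = refl
    ... | no t≢t = ⊥-elim (t≢t refl)

  U-future⇒U-future-feed : ∀ {Z : TSub} {D : FSub} →
    (∀ {t a u} → Z t a → U (eval D t) u → a ≤ u) →
    ∀ {s u} → U (future D s) u → U (future (feed Z) s) u
  U-future⇒U-future-feed below u≥D a (q , t , q∈Z , sRt , refl) =
    below (q∈Z t) λ b (q' , q'∈D , q't≡b) → u≥D b (q' , t , q'∈D , sRt , q't≡b)

  U-future-⊙ᶠ-diag⇒U-future : ACC → ∀ {𝟘} → (∀ x → 𝟘 ≤ x) →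
    ∀ {B s u} → U (future (feed (B ⊙ᶠ B)) s) u → U (future B s) u
  U-future-⊙ᶠ-diag⇒U-future acc 𝟘≤ {B} u≥BB a (q , t , q∈B , sRt , refl) =
    let (m , m∈BB , a≤m) = ⊙ˢ-diag-above acc (q , q∈B , refl)
        (q' , q'∈BB , q't≡m) =
          feed-through (λ t' → ⊙ˢ-nonempty acc 𝟘≤ (eval B t') (eval B t')) m∈BB
    in ≤-trans a≤m (u≥BB m (q' , t , q'∈BB , sRt , q't≡m))

  F-⊙ᶠ-idem : ACC → ∀ {𝟘} → (∀ x → 𝟘 ≤ x) → ∀ B → F (feed (B ⊙ᶠ B)) ≐ᵀ F B
  F-⊙ᶠ-idem acc 𝟘≤ B s a = Min-U-cong BB⇒B B⇒BB , Min-U-cong B⇒BB BB⇒B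
    where
    BB⇒B : ∀ u → U (future (feed (B ⊙ᶠ B)) s) u → U (future B s) u
    BB⇒B _ = U-future-⊙ᶠ-diag⇒U-future acc 𝟘≤
    B⇒BB : ∀ u → U (future B s) u → U (future (feed (B ⊙ᶠ B)) s) u
    B⇒BB _ = U-future⇒U-future-feed ⊙ˢ-below-Uˡ

  MaxL-F-⊙ᶠ-≤₁ : ACC → DCC → ∀ B C →
    MaxLᵀ (F (feed (B ⊙ᶠ C))) ≤₁ᵀ (MaxLᵀ (F B) ⊙ᵀ MaxLᵀ (F C))
  MaxL-F-⊙ᶠ-≤₁ acc dcc B C s x (x≤F[B⊙C] , _) = common-lower-bound⇒below-⊙ˢ acc
    (L-Min-U-antitone dcc (λ _ → U-future⇒U-future-feed ⊙ˢ-below-Uˡ) x≤F[B⊙C])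
    (L-Min-U-antitone dcc (λ _ → U-future⇒U-future-feed ⊙ˢ-below-Uʳ) x≤F[B⊙C])

theorem6p4 : ExcludedMiddle 0ℓ →
    (A : Set) (_≤_ : A → A → Set) (𝟘 𝟙 : A) →
    Order.IsBoundedPoset _≤_ 𝟘 𝟙 → Order.ACC _≤_ → Order.DCC _≤_ →
    (T : Set) (R : T → T → Set) → Order.Time.Serial _≤_ T R →
    (B C : (T → A) → Set) → Nonempty B → Nonempty C →
    let open Order _≤_
        open Time T
        open Tense R
    in ((P (feed (B ⊙ᶠ B)) ≐ᵀ P B) × (F (feed (B ⊙ᶠ B)) ≐ᵀ F B))
       × (MaxLᵀ (P (feed (B ⊙ᶠ C))) ≤₁ᵀ (MaxLᵀ (P B) ⊙ᵀ MaxLᵀ (P C)))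
       × (MaxLᵀ (F (feed (B ⊙ᶠ C))) ≤₁ᵀ (MaxLᵀ (F B) ⊙ᵀ MaxLᵀ (F C)))
theorem6p4 em A _≤_ 𝟘 𝟙 bounded acc dcc T R _ B C _ _ =
  (Past.F-⊙ᶠ-idem acc bot B , Future.F-⊙ᶠ-idem acc bot B) ,
  Past.MaxL-F-⊙ᶠ-≤₁ acc dcc B C , Future.MaxL-F-⊙ᶠ-≤₁ acc dcc B C
  where
  open Order.IsBoundedPoset bounded using (isPartialOrder; bot)
  module Future = FutureOperator em isPartialOrder T R
  -- past B s for R is, definitionally, future B s for the converse relation.
  module Past = FutureOperator em isPartialOrder T (flip R)
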